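{- Let $n,r\in\mathbb N$ with $n\ge r\ge2$. If $G$ is an $n$-vertex digraph such that $d^*_G(z)>(1-1/(r-1))n$ for every $z\in V(G)$, then $G$ contains a copy of $T_r$.
   Context: Digraphs have no loops and at most one edge in each direction between any pair of vertices. $d^*_G(z):=\max\{d^+_G(z),d^-_G(z)\}$. $T_r$ is the transitive tournament on $r$ vertices. -}

module Defs where

open import Data.Nat using (ℕ; _⊔_)
open import Data.Bool using (Bool; true; false; T)
open import Data.Fin using (Fin; _<_)
open import Data.Fin.Subset using (Subset; ∣_∣)
open import Data.Vec using (tabulate)
open import Relation.Binary.PropositionalEquality using (_≡_)
open import Function.Definitions using (Injective)
open import Data.Product using (Σ; _×_)

-- A digraph on vertex set Fin n: a Boolean adjacency relation (u → v iff adj u v ≡ true)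
-- with no loops. Since adj is a relation, there is at most one edge in each direction.
record Digraph (n : ℕ) : Set where
  field
    adj      : Fin n → Fin n → Bool
    loopless : ∀ v → adj v v ≡ false
open Digraph public

outNbhd : ∀ {n} → Digraph n → Fin n → Subset n
outNbhd G z = tabulate (λ w → adj G z w)

inNbhd : ∀ {n} → Digraph n → Fin n → Subset n
inNbhd G z = tabulate (λ w → adj G w z)

outdeg indeg : ∀ {n} → Digraph n → Fin n → ℕ
outdeg G z = ∣ outNbhd G z ∣
indeg  G z = ∣ inNbhd G z ∣

dstar : ∀ {n} → Digraph n → Fin n → ℕ
dstar G z = outdeg G z ⊔ indeg G z

ContainsTT : ∀ {n} → ℕ → Digraph n → Set
ContainsTT {n} r G =
  Σ (Fin r → Fin n) (λ f → Injective _≡_ _≡_ f × (∀ i j → i < j → T (adj G (f i) (f j))))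

-- Induction on k = r - 2 for a vertex set S with k·|S| < (k+1)·d*_S(z) for all z ∈ S.
-- Pick z ∈ S; reversing all edges if necessary, d*_S(z) is its out-degree in S, so
-- the out-neighbourhood N of z in S has more than k/(k+1)·|S| vertices. Passing from S
-- to N costs every w ∈ N at most |S| - |N| of its d*-degree, which is exactly enough
-- for N to satisfy the condition with k - 1. A T_(r-1) in N together with z is a T_r.
module Submission where

open import Defs
open import Data.Nat using (ℕ; zero; suc; _+_; _*_; _∸_; _⊔_; _≤_; _<_; z≤n; s≤s)
open import Data.Nat.Properties
open import Data.Nat.Tactic.RingSolver using (solve-∀)
open import Data.Bool using (Bool; T)
open import Data.Bool.Properties using (T-≡)
open import Data.Fin using (Fin; zero; suc; opposite) renaming (_<_ to _<ᶠ_)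
open import Data.Fin.Properties using (opposite-prop; opposite-involutive; toℕ<n)
open import Data.Fin.Subset using (Subset; _∈_; _∩_; _∪_; _⊆_; ∣_∣; ⊤; Nonempty; inside; outside)
open import Data.Fin.Subset.Properties
open import Data.Vec using ([]; _∷_; tabulate)
open import Data.Vec.Properties using ([]=⇒lookup; lookup∘tabulate)
open import Data.Product using (_,_; proj₁; proj₂)
open import Data.Sum using (inj₁; inj₂; [_,_])
open import Function using (_∘_)
open import Function.Bundles using (Equivalence)
open import Function.Definitions using (Injective)
open import Relation.Nullary using (yes; no; contradiction)
open import Relation.Binary.PropositionalEquality hiding ([_])

private
  variable
    n : ℕ

∣p∪q∣+∣p∩q∣≡∣p∣+∣q∣ : (p q : Subset n) → ∣ p ∪ q ∣ + ∣ p ∩ q ∣ ≡ ∣ p ∣ + ∣ q ∣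
∣p∪q∣+∣p∩q∣≡∣p∣+∣q∣ [] [] = refl
∣p∪q∣+∣p∩q∣≡∣p∣+∣q∣ (inside ∷ p) (inside ∷ q) =
  cong suc (trans (+-suc _ _) (trans (cong suc (∣p∪q∣+∣p∩q∣≡∣p∣+∣q∣ p q)) (sym (+-suc _ _))))
∣p∪q∣+∣p∩q∣≡∣p∣+∣q∣ (inside ∷ p) (outside ∷ q) = cong suc (∣p∪q∣+∣p∩q∣≡∣p∣+∣q∣ p q)
∣p∪q∣+∣p∩q∣≡∣p∣+∣q∣ (outside ∷ p) (inside ∷ q) =
  trans (cong suc (∣p∪q∣+∣p∩q∣≡∣p∣+∣q∣ p q)) (sym (+-suc _ _))
∣p∪q∣+∣p∩q∣≡∣p∣+∣q∣ (outside ∷ p) (outside ∷ q) = ∣p∪q∣+∣p∩q∣≡∣p∣+∣q∣ p q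

∣p∩r∣+∣q∩r∣≤∣p∩q∩r∣+∣r∣ : (p q r : Subset n) → ∣ p ∩ r ∣ + ∣ q ∩ r ∣ ≤ ∣ p ∩ q ∩ r ∣ + ∣ r ∣
∣p∩r∣+∣q∩r∣≤∣p∩q∩r∣+∣r∣ p q r = begin
  ∣ p ∩ r ∣ + ∣ q ∩ r ∣                         ≡⟨ ∣p∪q∣+∣p∩q∣≡∣p∣+∣q∣ (p ∩ r) (q ∩ r) ⟨
  ∣ p ∩ r ∪ q ∩ r ∣ + ∣ (p ∩ r) ∩ (q ∩ r) ∣     ≤⟨ +-mono-≤ (p⊆q⇒∣p∣≤∣q∣ union⊆r) (p⊆q⇒∣p∣≤∣q∣ meet⊆p∩q∩r) ⟩
  ∣ r ∣ + ∣ p ∩ q ∩ r ∣                         ≡⟨ +-comm ∣ r ∣ _ ⟩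
  ∣ p ∩ q ∩ r ∣ + ∣ r ∣                         ∎
  where
  open ≤-Reasoning
  union⊆r : p ∩ r ∪ q ∩ r ⊆ r
  union⊆r x∈ = [ p∩q⊆q p r , p∩q⊆q q r ] (x∈p∪q⁻ (p ∩ r) (q ∩ r) x∈)
  meet⊆p∩q∩r : (p ∩ r) ∩ (q ∩ r) ⊆ p ∩ q ∩ r
  meet⊆p∩q∩r x∈ with x∈p∩q⁻ (p ∩ r) (q ∩ r) x∈
  ... | x∈p∩r , x∈q∩r = x∈p∩q⁺ (proj₁ (x∈p∩q⁻ p r x∈p∩r) , x∈q∩r)

0<∣p∣⇒Nonempty : ∀ {n} (p : Subset n) → 0 < ∣ p ∣ → Nonempty p
0<∣p∣⇒Nonempty {n} p 0<∣p∣ with nonempty? p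
... | yes ne = ne
... | no ¬ne = contradiction (trans (cong ∣_∣ (Empty-unique ¬ne)) (∣⊥∣≡0 n)) (n>0⇒n≢0 0<∣p∣)

∈tabulate⇒T : ∀ {f : Fin n → Bool} {x} → x ∈ tabulate f → T (f x)
∈tabulate⇒T {f = f} {x} x∈ =
  Equivalence.from T-≡ (trans (sym (lookup∘tabulate f x)) ([]=⇒lookup x∈))

m<k*n⇒0<n : ∀ k {m n} → m < k * n → 0 < n
m<k*n⇒0<n k {m} {zero} m<k*0 = contradiction (subst (m <_) (*-zeroʳ k) m<k*0) n≮0
m<k*n⇒0<n k {n = suc _} _ = s≤s z≤n

-- Applied with s = |S|, m = |N|, d = d*_S(w), D = d*_N(w). The three hypotheses are
-- weighted by (k+2)(k+1), k+1 and 1 and added; cancelling leaves (k+2)(k·m+m+1) ≤ (k+2)(kD+D+m).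
density-step : ∀ k s m d D → d + m ≤ D + s →
  suc k * s < suc (suc k) * m → suc k * s < suc (suc k) * d → k * m < suc k * D
density-step k s m d D shrink dense-m dense-d =
  +-cancelˡ-≤ m _ _ (subst₂ _≤_ (unfold k m) (+-comm (K * D) m) (*-cancelˡ-≤ (suc K) weighted))
  where
  K = suc k
  unfold : ∀ k m → suc k * m + 1 ≡ m + suc (k * m)
  unfold = solve-∀
  lhs : ∀ K s m d → suc K * K * (d + s) + suc K * (K * m + 1)
                  ≡ suc K * K * (d + m) + (K * suc (K * s) + suc (K * s))
  lhs = solve-∀
  rhs : ∀ K s m d D → suc K * K * (D + s) + (K * (suc K * d) + suc K * m)
                    ≡ suc K * K * (d + s) + suc K * (K * D + m)
  rhs = solve-∀
  weighted : suc K * (K * m + 1) ≤ suc K * (K * D + m)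
  weighted = +-cancelˡ-≤ (suc K * K * (d + s)) _ _ (begin
    suc K * K * (d + s) + suc K * (K * m + 1)            ≡⟨ lhs K s m d ⟩
    suc K * K * (d + m) + (K * suc (K * s) + suc (K * s))
      ≤⟨ +-mono-≤ (*-monoʳ-≤ (suc K * K) shrink) (+-mono-≤ (*-monoʳ-≤ K dense-d) dense-m) ⟩
    suc K * K * (D + s) + (K * (suc K * d) + suc K * m)  ≡⟨ rhs K s m d D ⟩
    suc K * K * (d + s) + suc K * (K * D + m)            ∎)
    where open ≤-Reasoning

edge⇒distinct : (G : Digraph n) {u v : Fin n} → T (adj G u v) → u ≢ v
edge⇒distinct G {u} u→u refl = subst T (loopless G u) u→u

reverse : Digraph n → Digraph n
reverse G = record { adj = λ u v → adj G v u ; loopless = loopless G }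

outdegIn indegIn dstarIn : Digraph n → Subset n → Fin n → ℕ
outdegIn G S z = ∣ outNbhd G z ∩ S ∣
indegIn  G S z = ∣ inNbhd G z ∩ S ∣
dstarIn  G S z = outdegIn G S z ⊔ indegIn G S z

dstarIn-outNbhd : (G : Digraph n) (S : Subset n) (z w : Fin n) →
  dstarIn G S w + outdegIn G S z ≤ dstarIn G (outNbhd G z ∩ S) w + ∣ S ∣
dstarIn-outNbhd G S z w = begin
  (outdegIn G S w ⊔ indegIn G S w) + ∣ N ∣          ≡⟨ +-distribʳ-⊔ ∣ N ∣ (outdegIn G S w) _ ⟩
  (outdegIn G S w + ∣ N ∣) ⊔ (indegIn G S w + ∣ N ∣)
    ≤⟨ ⊔-mono-≤ (∣p∩r∣+∣q∩r∣≤∣p∩q∩r∣+∣r∣ (outNbhd G w) (outNbhd G z) S)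
                (∣p∩r∣+∣q∩r∣≤∣p∩q∩r∣+∣r∣ (inNbhd G w) (outNbhd G z) S) ⟩
  (outdegIn G N w + ∣ S ∣) ⊔ (indegIn G N w + ∣ S ∣) ≡⟨ +-distribʳ-⊔ ∣ S ∣ (outdegIn G N w) _ ⟨
  dstarIn G N w + ∣ S ∣                              ∎
  where
  open ≤-Reasoning
  N = outNbhd G z ∩ S

Dense : ℕ → Digraph n → Subset n → Set
Dense k G S = ∀ {z} → z ∈ S → k * ∣ S ∣ < suc k * dstarIn G S z

Dense-reverse : ∀ k (G : Digraph n) S → Dense k G S → Dense k (reverse G) S
Dense-reverse k G S dense {z} z∈S =
  subst (λ d → k * ∣ S ∣ < suc k * d) (⊔-comm (outdegIn G S z) _) (dense z∈S)

Dense-outNbhd : ∀ k (G : Digraph n) S {z} → z ∈ S → dstarIn G S z ≡ outdegIn G S z →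
  Dense (suc k) G S → Dense k G (outNbhd G z ∩ S)
Dense-outNbhd k G S {z} z∈S dstar≡out dense {w} w∈N =
  density-step k ∣ S ∣ (outdegIn G S z) (dstarIn G S w) _
    (dstarIn-outNbhd G S z w)
    (subst (λ d → suc k * ∣ S ∣ < suc (suc k) * d) dstar≡out (dense z∈S))
    (dense (p∩q⊆q _ S w∈N))

outNbhd-nonempty : ∀ k (G : Digraph n) S {z} → z ∈ S → dstarIn G S z ≡ outdegIn G S z →
  Dense k G S → Nonempty (outNbhd G z ∩ S)
outNbhd-nonempty k G S z∈S dstar≡out dense = 0<∣p∣⇒Nonempty _ (m<k*n⇒0<n (suc k)
  (subst (λ d → k * ∣ S ∣ < suc k * d) dstar≡out (dense z∈S)))

record TTIn (G : Digraph n) (S : Subset n) (r : ℕ) : Set where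
  field
    vertex      : Fin r → Fin n
    injective   : Injective _≡_ _≡_ vertex
    vertex∈     : ∀ i → vertex i ∈ S
    transitive  : ∀ i j → i <ᶠ j → T (adj G (vertex i) (vertex j))
open TTIn

TT-single : {G : Digraph n} {S : Subset n} {z : Fin n} → z ∈ S → TTIn G S 1
TT-single {z = z} z∈S = record
  { vertex     = λ _ → z
  ; injective  = λ { {zero} {zero} _ → refl }
  ; vertex∈    = λ _ → z∈S
  ; transitive = λ { zero zero () }
  }

TT-cons : {G : Digraph n} {S : Subset n} {z : Fin n} {r : ℕ} →
  z ∈ S → TTIn G (outNbhd G z ∩ S) r → TTIn G S (suc r)
TT-cons {G = G} {S} {z} {r} z∈S tt = record
  { vertex     = f
  ; injective  = injective′
  ; vertex∈    = λ { zero → z∈S ; (suc i) → p∩q⊆q _ S (vertex∈ tt i) }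
  ; transitive = transitive′
  }
  where
  f : Fin (suc r) → _
  f zero    = z
  f (suc i) = vertex tt i
  z→ : ∀ i → T (adj G z (vertex tt i))
  z→ i = ∈tabulate⇒T (p∩q⊆p _ S (vertex∈ tt i))
  injective′ : Injective _≡_ _≡_ f
  injective′ {zero}  {zero}  _  = refl
  injective′ {zero}  {suc j} eq = contradiction eq (edge⇒distinct G (z→ j))
  injective′ {suc i} {zero}  eq = contradiction (sym eq) (edge⇒distinct G (z→ i))
  injective′ {suc i} {suc j} eq = cong suc (injective tt eq)
  transitive′ : ∀ i j → i <ᶠ j → T (adj G (f i) (f j))
  transitive′ zero    (suc j) _       = z→ j
  transitive′ (suc i) (suc j) (s≤s i<j) = transitive tt i j i<j

opposite-< : ∀ {r} {i j : Fin r} → i <ᶠ j → opposite j <ᶠ opposite i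
opposite-< {r} {i} {j} i<j = subst₂ _<_ (sym (opposite-prop j)) (sym (opposite-prop i))
  (∸-monoʳ-< (s≤s i<j) (toℕ<n j))

TT-reverse : {G : Digraph n} {S : Subset n} {r : ℕ} → TTIn (reverse G) S r → TTIn G S r
TT-reverse tt = record
  { vertex     = vertex tt ∘ opposite
  ; injective  = λ {i} {j} eq →
      trans (sym (opposite-involutive i)) (trans (cong opposite (injective tt eq)) (opposite-involutive j))
  ; vertex∈    = vertex∈ tt ∘ opposite
  ; transitive = λ i j i<j → transitive tt (opposite j) (opposite i) (opposite-< i<j)
  }

mutual
  Dense⇒TT : ∀ k (G : Digraph n) S → Nonempty S → Dense k G S → TTIn G S (suc (suc k))
  Dense⇒TT k G S (z , z∈S) dense with ⊔-sel (outdegIn G S z) (indegIn G S z)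
  ... | inj₁ dstar≡out = TT-cons z∈S (TT-in-outNbhd k G S z∈S dstar≡out dense)
  ... | inj₂ dstar≡in  = TT-reverse (TT-cons z∈S
    (TT-in-outNbhd k (reverse G) S z∈S (trans (⊔-comm (indegIn G S z) _) dstar≡in)
      (Dense-reverse k G S dense)))

  TT-in-outNbhd : ∀ k (G : Digraph n) S {z} → z ∈ S → dstarIn G S z ≡ outdegIn G S z →
    Dense k G S → TTIn G (outNbhd G z ∩ S) (suc k)
  TT-in-outNbhd zero G S z∈S dstar≡out dense =
    TT-single (proj₂ (outNbhd-nonempty zero G S z∈S dstar≡out dense))
  TT-in-outNbhd (suc k) G S z∈S dstar≡out dense =
    Dense⇒TT k G _ (outNbhd-nonempty (suc k) G S z∈S dstar≡out dense)
      (Dense-outNbhd k G S z∈S dstar≡out dense)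

fact6p2 : (n r : ℕ) → 2 ≤ r → r ≤ n → (G : Digraph n) →
    (∀ (z : Fin n) → (r ∸ 2) * n < (r ∸ 1) * dstar G z) →
    ContainsTT r G
fact6p2 n (suc zero) (s≤s ()) _ _ _
fact6p2 n (suc (suc k)) _ r≤n G hyp = vertex tt , injective tt , transitive tt
  where
  dstarIn-⊤ : ∀ z → dstarIn G ⊤ z ≡ dstar G z
  dstarIn-⊤ z = cong₂ _⊔_ (cong ∣_∣ (∩-identityʳ (outNbhd G z))) (cong ∣_∣ (∩-identityʳ (inNbhd G z)))
  dense : Dense k G ⊤
  dense {z} _ = subst₂ (λ s d → k * s < suc k * d) (sym (∣⊤∣≡n n)) (sym (dstarIn-⊤ z)) (hyp z)
  tt : TTIn G ⊤ (suc (suc k))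
  tt = Dense⇒TT k G ⊤ (0<∣p∣⇒Nonempty ⊤ (subst (0 <_) (sym (∣⊤∣≡n n)) (≤-trans (s≤s z≤n) r≤n))) dense
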